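{- Let $\Phi\subseteq\{I,O,Q,U,\mathit{Self}\}$. For every interpretation $\mathcal{I}$, the largest $\mathcal{L}_\Phi$-auto-bisimulation of $\mathcal{I}$ exists and is an equivalence relation on $\Delta^{\mathcal{I}}$.
   Context: Fix finite sets $\Sigma_C,\Sigma_R,\Sigma_I$ of concept, role and individual names. An interpretation $\mathcal{I}$ has nonempty domain $\Delta^{\mathcal{I}}$, $A^{\mathcal{I}}\subseteq\Delta^{\mathcal{I}}$ ($A\in\Sigma_C$), $r^{\mathcal{I}}\subseteq(\Delta^{\mathcal{I}})^2$ ($r\in\Sigma_R$), $a^{\mathcal{I}}\in\Delta^{\mathcal{I}}$ ($a\in\Sigma_I$). For interpretations $\mathcal{I},\mathcal{I}'$, $Z\subseteq\Delta^{\mathcal{I}}\times\Delta^{\mathcal{I}'}$ is an $\mathcal{L}_\Phi$-bisimulation if for all $a,A,r$, $x,y\in\Delta^{\mathcal{I}}$, $x',y'\in\Delta^{\mathcal{I}'}$: (B1) $Z(a^{\mathcal{I}},a^{\mathcal{I}'})$; (B2) $Z(x,x')\Rightarrow(x\in A^{\mathcal{I}}\iff x'\in A^{\mathcal{I}'})$; (B3) $Z(x,x')\wedge(x,y)\in r^{\mathcal{I}}\Rightarrow\exists y'(Z(y,y')\wedge(x',y')\in r^{\mathcal{I}'})$; (B4) $Z(x,x')\wedge(x',y')\in r^{\mathcal{I}'}\Rightarrow\exists y(Z(y,y')\wedge(x,y)\in r^{\mathcal{I}})$; if $I\in\Phi$: (B5) $Z(x,x')\wedge(y,x)\in r^{\mathcal{I}}\Rightarrow\exists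 y'(Z(y,y')\wedge(y',x')\in r^{\mathcal{I}'})$, (B6) $Z(x,x')\wedge(y',x')\in r^{\mathcal{I}'}\Rightarrow\exists y(Z(y,y')\wedge(y,x)\in r^{\mathcal{I}})$; if $O\in\Phi$: (B7) $Z(x,x')\Rightarrow(x=a^{\mathcal{I}}\iff x'=a^{\mathcal{I}'})$; if $Q\in\Phi$: (B8) $Z(x,x')$ implies for every $r$ a bijection $h$ from $\{y:(x,y)\in r^{\mathcal{I}}\}$ onto $\{y':(x',y')\in r^{\mathcal{I}'}\}$ with $h\subseteq Z$; if $Q,I\in\Phi$ also (B9) the same for $\{y:(y,x)\in r^{\mathcal{I}}\}$ and $\{y':(y',x')\in r^{\mathcal{I}'}\}$; if $U\in\Phi$: (B10) every $x$ is $Z$-related to some $x'$, (B11) every $x'$ is $Z$-related to some $x$; if $\mathit{Self}\in\Phi$: (B12) $Z(x,x')\Rightarrow((x,x)\in r^{\mathcal{I}}\iff(x',x')\in r^{\mathcal{I}'})$. An $\mathcal{L}_\Phi$-auto-bisimulation of $\mathcal{I}$ is an $\mathcal{L}_\Phi$-bisimulation between $\mathcal{I}$ and itself; it is the largest if it contains every $\mathcal{L}_\Phi$-auto-bisimulation of $\mathcal{I}$. -}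

module Defs where

open import Level using (Level; _⊔_; suc)
open import Data.Bool using (Bool; T)
open import Data.Fin using (Fin)
open import Data.Nat using (ℕ)
open import Data.Product using (Σ; ∃; _×_; _,_; proj₁)
open import Function.Bundles using (_⤖_; Bijection)
open import Relation.Binary.PropositionalEquality using (_≡_)

data Feature : Set where
  I O Q U Self : Feature

FeatureSet : Set
FeatureSet = Feature → Bool

record Interp (ℓ : Level) (nC nR nI : ℕ) : Set (suc ℓ) where
  field
    Δ       : Set ℓ
    inhabit : Δ
    conc    : Fin nC → Δ → Set ℓ
    role    : Fin nR → Δ → Δ → Set ℓ
    ind     : Fin nI → Δ
    conc-prop : ∀ A x (p q : conc A x) → p ≡ q
    role-prop : ∀ r x y (p q : role r x y) → p ≡ q

open Interp public

module _ {ℓ ℓz : Level} {nC nR nI : ℕ} (Φ : FeatureSet)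
         (𝓘 𝓘' : Interp ℓ nC nR nI) where

  private
    D  = Δ 𝓘
    D' = Δ 𝓘'

  -- successors / predecessors as subsets (Σ-types over propositional relations)
  Succ : ∀ {ℓ'} {nC' nR' nI'} (J : Interp ℓ' nC' nR' nI') → Fin nR' → Δ J → Set ℓ'
  Succ J r x = Σ (Δ J) (λ y → role J r x y)

  Pred : ∀ {ℓ'} {nC' nR' nI'} (J : Interp ℓ' nC' nR' nI') → Fin nR' → Δ J → Set ℓ'
  Pred J r x = Σ (Δ J) (λ y → role J r y x)

  record IsBisim (Z : D → D' → Set ℓz) : Set (ℓ ⊔ ℓz) where
    field
      B1 : ∀ a → Z (ind 𝓘 a) (ind 𝓘' a)
      B2 : ∀ A x x' → Z x x' → (conc 𝓘 A x → conc 𝓘' A x') × (conc 𝓘' A x' → conc 𝓘 A x)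
      B3 : ∀ r x x' y → Z x x' → role 𝓘 r x y → ∃ λ y' → Z y y' × role 𝓘' r x' y'
      B4 : ∀ r x x' y' → Z x x' → role 𝓘' r x' y' → ∃ λ y → Z y y' × role 𝓘 r x y
      B5 : T (Φ I) → ∀ r x x' y → Z x x' → role 𝓘 r y x → ∃ λ y' → Z y y' × role 𝓘' r y' x'
      B6 : T (Φ I) → ∀ r x x' y' → Z x x' → role 𝓘' r y' x' → ∃ λ y → Z y y' × role 𝓘 r y x
      B7 : T (Φ O) → ∀ a x x' → Z x x' → (x ≡ ind 𝓘 a → x' ≡ ind 𝓘' a) × (x' ≡ ind 𝓘' a → x ≡ ind 𝓘 a)
      B8 : T (Φ Q) → ∀ r x x' → Z x x' →
           Σ (Succ 𝓘 r x ⤖ Succ 𝓘' r x') λ h →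
             ∀ y → Z (proj₁ y) (proj₁ (Bijection.to h y))
      B9 : T (Φ Q) → T (Φ I) → ∀ r x x' → Z x x' →
           Σ (Pred 𝓘 r x ⤖ Pred 𝓘' r x') λ h →
             ∀ y → Z (proj₁ y) (proj₁ (Bijection.to h y))
      B10 : T (Φ U) → ∀ x → ∃ λ x' → Z x x'
      B11 : T (Φ U) → ∀ x' → ∃ λ x → Z x x'
      B12 : T (Φ Self) → ∀ r x x' → Z x x' →
            (role 𝓘 r x x → role 𝓘' r x' x') × (role 𝓘' r x' x' → role 𝓘 r x x)

-- L_Φ-bisimulations are closed under the relational operations that
-- make up the axioms of an equivalence relation:
--   * the identity relation of 𝓘 is an auto-bisimulation of 𝓘;
--   * the converse of a bisimulation between 𝓘 and 𝓙 is one between 𝓙 and 𝓘;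
--   * the composite of bisimulations 𝓘 ~ 𝓙 and 𝓙 ~ 𝓚 is one between 𝓘 and 𝓚;
--   * the union of a nonempty family of bisimulations is a bisimulation.
-- The largest auto-bisimulation is then the union of ALL auto-bisimulations
-- (of level ℓ) of 𝓘; the family is nonempty since it contains the identity.
-- It contains every auto-bisimulation by construction, and it is reflexive,
-- symmetric and transitive because identity, converses and composites of
-- auto-bisimulations are again members of the family.  (The union lives one
-- universe level up, since it quantifies over relations on Δ 𝓘.)
module Submission where

open import Defs
open import Level using (Level; _⊔_; suc)
open import Data.Nat using (ℕ)
open import Data.Product using (Σ; ∃; _×_; _,_; proj₁; proj₂; swap)
open import Function.Base using (flip)
open import Function.Bundles using (_⤖_; Bijection)
import Function.Properties.Bijection as Bij
open import Relation.Binary.Core using (REL)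
open import Relation.Binary.Structures using (IsEquivalence)
open import Relation.Binary.PropositionalEquality using (_≡_; refl; subst)

open IsBisim

_⨾_ : ∀ {a b c ℓ₁ ℓ₂} {A : Set a} {B : Set b} {C : Set c} →
  REL A B ℓ₁ → REL B C ℓ₂ → REL A C (b ⊔ ℓ₁ ⊔ ℓ₂)
(Z₁ ⨾ Z₂) x z = ∃ λ y → Z₁ x y × Z₂ y z

chain-⇔ : ∀ {a b c} {A : Set a} {B : Set b} {C : Set c} →
  (A → B) × (B → A) → (B → C) × (C → B) → (A → C) × (C → A)
chain-⇔ (f , f⁻) (g , g⁻) = (λ x → g (f x)) , (λ z → f⁻ (g⁻ z))

-- The inverse of a bijection is a right inverse; this transports the
-- "h ⊆ Z" condition of B8/B9 from h to its inverse in the converse relation.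
to-sym-≡ : ∀ {a b} {A : Set a} {B : Set b} (h : A ⤖ B) (y : B) →
  Bijection.to h (Bijection.to (Bij.sym-≡ h) y) ≡ y
to-sym-≡ h y = proj₂ (Bijection.strictlySurjective h y)

module _ {ℓ : Level} {nC nR nI : ℕ} (Φ : FeatureSet) where

  identity-bisim : (𝓘 : Interp ℓ nC nR nI) → IsBisim Φ 𝓘 𝓘 _≡_
  B1 (identity-bisim 𝓘) a = refl
  B2 (identity-bisim 𝓘) A x .x refl = (λ p → p) , (λ p → p)
  B3 (identity-bisim 𝓘) r x .x y refl p = y , refl , p
  B4 (identity-bisim 𝓘) r x .x y refl p = y , refl , p
  B5 (identity-bisim 𝓘) _ r x .x y refl p = y , refl , p
  B6 (identity-bisim 𝓘) _ r x .x y refl p = y , refl , p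
  B7 (identity-bisim 𝓘) _ a x .x refl = (λ p → p) , (λ p → p)
  B8 (identity-bisim 𝓘) _ r x .x refl = Bij.refl , λ y → refl
  B9 (identity-bisim 𝓘) _ _ r x .x refl = Bij.refl , λ y → refl
  B10 (identity-bisim 𝓘) _ x = x , refl
  B11 (identity-bisim 𝓘) _ x = x , refl
  B12 (identity-bisim 𝓘) _ r x .x refl = (λ p → p) , (λ p → p)

  converse-bisim : ∀ {ℓz} {𝓘 𝓙 : Interp ℓ nC nR nI} {Z : REL (Δ 𝓘) (Δ 𝓙) ℓz} →
    IsBisim Φ 𝓘 𝓙 Z → IsBisim Φ 𝓙 𝓘 (flip Z)
  converse-bisim {𝓘 = 𝓘} {𝓙 = 𝓙} {Z = Z} b = record
    { B1 = B1 b
    ; B2 = λ A x x' z → swap (B2 b A x' x z)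
    ; B3 = λ r x x' y z → B4 b r x' x y z
    ; B4 = λ r x x' y z → B3 b r x' x y z
    ; B5 = λ i r x x' y z → B6 b i r x' x y z
    ; B6 = λ i r x x' y z → B5 b i r x' x y z
    ; B7 = λ o a x x' z → swap (B7 b o a x' x z)
    ; B8 = λ q r x x' z → invert (B8 b q r x' x z)
    ; B9 = λ q i r x x' z → invert (B9 b q i r x' x z)
    ; B10 = B11 b
    ; B11 = B10 b
    ; B12 = λ s r x x' z → swap (B12 b s r x' x z)
    }
    where
    invert : ∀ {P : Set ℓ} {P' : Set ℓ} {π : P → Δ 𝓘} {π' : P' → Δ 𝓙} →
      Σ (P ⤖ P') (λ h → ∀ y → Z (π y) (π' (Bijection.to h y))) →
      Σ (P' ⤖ P) (λ g → ∀ y → Z (π (Bijection.to g y)) (π' y))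
    invert {π = π} {π' = π'} (h , h⊆Z) =
      Bij.sym-≡ h ,
      λ y → subst (λ w → Z (π (Bijection.to (Bij.sym-≡ h) y)) (π' w))
                  (to-sym-≡ h y) (h⊆Z _)

  composite-bisim : ∀ {ℓ₁ ℓ₂} {𝓘 𝓙 𝓚 : Interp ℓ nC nR nI}
    {Z₁ : REL (Δ 𝓘) (Δ 𝓙) ℓ₁} {Z₂ : REL (Δ 𝓙) (Δ 𝓚) ℓ₂} →
    IsBisim Φ 𝓘 𝓙 Z₁ → IsBisim Φ 𝓙 𝓚 Z₂ → IsBisim Φ 𝓘 𝓚 (Z₁ ⨾ Z₂)
  B1 (composite-bisim b c) a = _ , B1 b a , B1 c a
  B2 (composite-bisim b c) A x x'' (x' , z₁ , z₂) = chain-⇔ (B2 b A x x' z₁) (B2 c A x' x'' z₂)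
  B3 (composite-bisim b c) r x x'' y (x' , z₁ , z₂) p =
    let (y' , w₁ , p') = B3 b r x x' y z₁ p ; (y'' , w₂ , p'') = B3 c r x' x'' y' z₂ p'
    in y'' , (y' , w₁ , w₂) , p''
  B4 (composite-bisim b c) r x x'' y'' (x' , z₁ , z₂) p'' =
    let (y' , w₂ , p') = B4 c r x' x'' y'' z₂ p'' ; (y , w₁ , p) = B4 b r x x' y' z₁ p'
    in y , (y' , w₁ , w₂) , p
  B5 (composite-bisim b c) i r x x'' y (x' , z₁ , z₂) p =
    let (y' , w₁ , p') = B5 b i r x x' y z₁ p ; (y'' , w₂ , p'') = B5 c i r x' x'' y' z₂ p'
    in y'' , (y' , w₁ , w₂) , p''
  B6 (composite-bisim b c) i r x x'' y'' (x' , z₁ , z₂) p'' =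
    let (y' , w₂ , p') = B6 c i r x' x'' y'' z₂ p'' ; (y , w₁ , p) = B6 b i r x x' y' z₁ p'
    in y , (y' , w₁ , w₂) , p
  B7 (composite-bisim b c) o a x x'' (x' , z₁ , z₂) = chain-⇔ (B7 b o a x x' z₁) (B7 c o a x' x'' z₂)
  B8 (composite-bisim b c) q r x x'' (x' , z₁ , z₂) =
    let (h , h⊆Z₁) = B8 b q r x x' z₁ ; (g , g⊆Z₂) = B8 c q r x' x'' z₂
    in Bij.trans h g , λ y → _ , h⊆Z₁ y , g⊆Z₂ _
  B9 (composite-bisim b c) q i r x x'' (x' , z₁ , z₂) =
    let (h , h⊆Z₁) = B9 b q i r x x' z₁ ; (g , g⊆Z₂) = B9 c q i r x' x'' z₂
    in Bij.trans h g , λ y → _ , h⊆Z₁ y , g⊆Z₂ _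
  B10 (composite-bisim b c) u x =
    let (x' , z₁) = B10 b u x ; (x'' , z₂) = B10 c u x' in x'' , x' , z₁ , z₂
  B11 (composite-bisim b c) u x'' =
    let (x' , z₂) = B11 c u x'' ; (x , z₁) = B11 b u x' in x , x' , z₁ , z₂
  B12 (composite-bisim b c) s r x x'' (x' , z₁ , z₂) = chain-⇔ (B12 b s r x x' z₁) (B12 c s r x' x'' z₂)

  ⋃ : ∀ {k ℓz} {A B : Set ℓ} (K : Set k) → (K → REL A B ℓz) → REL A B (k ⊔ ℓz)
  ⋃ K Z x y = ∃ λ k → Z k x y

  -- Every
  -- local condition is inherited from the member relating the given pair; the
  -- global conditions B1, B10, B11 come from an arbitrary member k₀.
  union-bisim : ∀ {k ℓz} {𝓘 𝓙 : Interp ℓ nC nR nI} {K : Set k}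
    {Z : K → REL (Δ 𝓘) (Δ 𝓙) ℓz} →
    (∀ k → IsBisim Φ 𝓘 𝓙 (Z k)) → K → IsBisim Φ 𝓘 𝓙 (⋃ K Z)
  B1 (union-bisim b k₀) a = k₀ , B1 (b k₀) a
  B2 (union-bisim b _) A x x' (k , z) = B2 (b k) A x x' z
  B3 (union-bisim b _) r x x' y (k , z) p = let (y' , w , p') = B3 (b k) r x x' y z p in y' , (k , w) , p'
  B4 (union-bisim b _) r x x' y' (k , z) p = let (y , w , p') = B4 (b k) r x x' y' z p in y , (k , w) , p'
  B5 (union-bisim b _) i r x x' y (k , z) p = let (y' , w , p') = B5 (b k) i r x x' y z p in y' , (k , w) , p'
  B6 (union-bisim b _) i r x x' y' (k , z) p = let (y , w , p') = B6 (b k) i r x x' y' z p in y , (k , w) , p'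
  B7 (union-bisim b _) o a x x' (k , z) = B7 (b k) o a x x' z
  B8 (union-bisim b _) q r x x' (k , z) = let (h , h⊆Z) = B8 (b k) q r x x' z in h , λ y → k , h⊆Z y
  B9 (union-bisim b _) q i r x x' (k , z) = let (h , h⊆Z) = B9 (b k) q i r x x' z in h , λ y → k , h⊆Z y
  B10 (union-bisim b k₀) u x = let (x' , z) = B10 (b k₀) u x in x' , k₀ , z
  B11 (union-bisim b k₀) u x' = let (x , z) = B11 (b k₀) u x' in x , k₀ , z
  B12 (union-bisim b _) s r x x' (k , z) = B12 (b k) s r x x' z

  module Largest (𝓘 : Interp ℓ nC nR nI) where

    AutoBisim : Set (suc ℓ)
    AutoBisim = Σ (REL (Δ 𝓘) (Δ 𝓘) ℓ) (IsBisim Φ 𝓘 𝓘)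

    _~_ : REL (Δ 𝓘) (Δ 𝓘) (suc ℓ)
    _~_ = ⋃ AutoBisim proj₁

    ~-bisim : IsBisim Φ 𝓘 𝓘 _~_
    ~-bisim = union-bisim proj₂ (_≡_ , identity-bisim 𝓘)

    ~-largest : ∀ (Z : REL (Δ 𝓘) (Δ 𝓘) ℓ) → IsBisim Φ 𝓘 𝓘 Z → ∀ x y → Z x y → x ~ y
    ~-largest Z b x y z = (Z , b) , z

    ~-equivalence : IsEquivalence _~_
    ~-equivalence = record
      { refl  = (_≡_ , identity-bisim 𝓘) , refl
      ; sym   = λ { ((Z , b) , z) → (flip Z , converse-bisim b) , z }
      ; trans = λ { ((Z₁ , b₁) , z₁) ((Z₂ , b₂) , z₂) →
                    (Z₁ ⨾ Z₂ , composite-bisim b₁ b₂) , (_ , z₁ , z₂) }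
      }

proposition1 : ∀ {ℓ : Level} {nC nR nI : ℕ} (Φ : FeatureSet) (𝓘 : Interp ℓ nC nR nI) →
    Σ (Δ 𝓘 → Δ 𝓘 → Set (suc ℓ)) λ Z →
      IsBisim {ℓz = suc ℓ} Φ 𝓘 𝓘 Z
      × (∀ (Z' : Δ 𝓘 → Δ 𝓘 → Set ℓ) → IsBisim {ℓz = ℓ} Φ 𝓘 𝓘 Z' → ∀ x y → Z' x y → Z x y)
      × IsEquivalence Z
proposition1 Φ 𝓘 = _~_ , ~-bisim , ~-largest , ~-equivalence
  where open Largest Φ 𝓘
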